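{- Let $\mathcal{R}$ be a right-stable DCTRS and let $u \rightarrow^*_{\mathbb{U}_{seq}(\mathcal{R})} v$ be an innermost derivation with $u \in \mathcal{T}$. Then $u \rightarrow^*_{\mathcal{R}} \mathsf{tb}(v)$.
   Context: Terms $\mathcal{T}=\mathcal{T}(\mathcal{F},\mathcal{V})$ over a signature $\mathcal{F}$ and a countably infinite set of variables $\mathcal{V}$. An (oriented) conditional rule has the form $l \rightarrow r \Leftarrow s_1 \rightarrow^* t_1, \ldots, s_k \rightarrow^* t_k$ ($k\ge 0$). It is deterministic if $\mathcal{V}ar(r) \subseteq \mathcal{V}ar(l) \cup \mathcal{V}ar(s_1,t_1,\ldots,s_k,t_k)$ and $\mathcal{V}ar(s_i) \subseteq \mathcal{V}ar(l, t_1, \ldots, t_{i-1})$ for all $i$. A DCTRS $\mathcal{R}$ is a set of such rules; $\mathcal{R}_u=\{l\rightarrow r \mid l \rightarrow r \Leftarrow c \in \mathcal{R}\}$. Rewrite relation: $\mathcal{R}_0=\emptyset$, $\mathcal{R}_{n+1}=\{l\sigma \rightarrow r\sigma \mid l \rightarrow r \Leftarrow s_1 \rightarrow^* t_1,\ldots \in \mathcal{R},\ s_j\sigma \rightarrow^*_{\mathcal{R}_n} t_j\sigma \text{ for all } j\}$, $\rightarrow_{\mathcal{R}}=\bigcup_n \rightarrow_{\mathcal{R}_n}$. $\mathcal{R}$ is right-stable if for every rule and every $i$, $t_i$ is either a linear constructor term (no root symbol of a left-hand side of $\mathcal{R}$ occurs in it) or a ground term irreducible w.r.t. $\mathcal{R}_u$,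 and $\mathcal{V}ar(t_i) \cap \mathcal{V}ar(l, s_1, t_1, \ldots, s_{i-1}, t_{i-1}, s_i) = \emptyset$. Sequential unraveling: for $\alpha: l \rightarrow r \Leftarrow s_1 \rightarrow^* t_1, \ldots, s_k \rightarrow^* t_k$ with $k\ge1$, let $X_i=\mathcal{V}ar(l,t_1,\ldots,t_{i-1})$ with fixed ordering $\vec{X_i}$, fresh symbols $U^\alpha_1,\dots,U^\alpha_k$, and $\mathbb{U}_{seq}(\alpha)=\{l \rightarrow U^\alpha_1(s_1,\vec{X_1})\}\cup\{U^\alpha_i(t_i,\vec{X_i}) \rightarrow U^\alpha_{i+1}(s_{i+1},\vec{X_{i+1}}) \mid 1\le i<k\}\cup\{U^\alpha_k(t_k,\vec{X_k}) \rightarrow r\}$; unconditional rules are kept unchanged. $\mathbb{U}_{seq}(\mathcal{R})=\bigcup_{\alpha}\mathbb{U}_{seq}(\alpha)$; terms over the extended signature are mixed terms. Back-translation $\mathsf{tb}$ from mixed terms to $\mathcal{T}$: $\mathsf{tb}(x)=x$; $\mathsf{tb}(f(s_1,\ldots,s_n))=f(\mathsf{tb}(s_1),\ldots,\mathsf{tb}(s_n))$ for $f\in\mathcal{F}$; $\mathsf{tb}(U^\alpha_i(w,v_1,\ldots,v_m))=l\sigma$ where $l$ is the left-hand side of $\alpha$ and $x_j\sigma=\mathsf{tb}(v_j)$ with $x_1,\ldots,x_m=\vec{X_i}$. A derivation is innermost if each step contracts a redex no proper subterm of which is a redex. -}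

module Defs where

open import Data.Nat using (ℕ; zero; suc; _≟_)
open import Data.Fin using (Fin; toℕ)
open import Data.List using (List; []; _∷_; _++_; length; concatMap; take; deduplicate; lookup)
open import Data.Vec as V using (Vec; []; _∷_)
open import Data.Product using (Σ; ∃; _×_; _,_; proj₁; proj₂)
open import Data.Sum using (_⊎_; inj₁; inj₂)
open import Data.Empty using (⊥)
open import Relation.Nullary using (¬_; does)
open import Data.Bool using (if_then_else_)
open import Relation.Binary.PropositionalEquality using (_≡_)
open import Relation.Binary.Construct.Closure.ReflexiveTransitive using (Star)
open import Data.List.Membership.Propositional using (_∈_; _∉_)
open import Data.List.Relation.Unary.All using (All)
open import Data.List.Relation.Unary.Unique.Propositional using (Unique)

data Term {S : Set} (a : S → ℕ) : Set where
  var : ℕ → Term a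
  fun : (f : S) → Vec (Term a) (a f) → Term a

module _ {S : Set} {a : S → ℕ} where

  vars  : Term a → List ℕ
  varsV : ∀ {n} → Vec (Term a) n → List ℕ
  vars (var x)    = x ∷ []
  vars (fun f ts) = varsV ts
  varsV []       = []
  varsV (t ∷ ts) = vars t ++ varsV ts

  funs  : Term a → List S
  funsV : ∀ {n} → Vec (Term a) n → List S
  funs (var x)    = []
  funs (fun f ts) = f ∷ funsV ts
  funsV []       = []
  funsV (t ∷ ts) = funs t ++ funsV ts

  Subst : Set
  Subst = ℕ → Term a

  _⟨_⟩   : Term a → Subst → Term a
  substV : ∀ {n} → Vec (Term a) n → Subst → Vec (Term a) n
  var x ⟨ σ ⟩    = σ x
  fun f ts ⟨ σ ⟩ = fun f (substV ts σ)
  substV [] σ       = []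
  substV (t ∷ ts) σ = (t ⟨ σ ⟩) ∷ substV ts σ

  data Ctx (Rt : Term a → Term a → Set) : Term a → Term a → Set where
    root : ∀ {s t} → Rt s t → Ctx Rt s t
    arg  : ∀ {f ts t} (i : Fin (a f)) → Ctx Rt (V.lookup ts i) t →
           Ctx Rt (fun f ts) (fun f (ts V.[ i ]≔ t))

  data _⊲_ : Term a → Term a → Set where
    imm  : ∀ {f ts} (i : Fin (a f)) → V.lookup ts i ⊲ fun f ts
    deep : ∀ {s f ts} (i : Fin (a f)) → s ⊲ V.lookup ts i → s ⊲ fun f ts

-- Conditional rules  l → r ⇐ s₁ →* t₁, …, sₖ →* tₖ  (conds = [(s₁,t₁),…])

record Rule {F : Set} (ar : F → ℕ) : Set where
  constructor _⇒_⇐_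
  field
    lhs   : Term ar
    rhs   : Term ar
    conds : List (Term ar × Term ar)
open Rule public

module _ {F : Set} {ar : F → ℕ} {I : Set} (R : I → Rule ar) where

  k : I → ℕ
  k α = length (conds (R α))

  -- i-th condition (0-based index i : Fin k stands for condition i+1)
  cs : (α : I) → Fin (k α) → Term ar
  cs α i = proj₁ (lookup (conds (R α)) i)
  ct : (α : I) → Fin (k α) → Term ar
  ct α i = proj₂ (lookup (conds (R α)) i)

  varsT : I → ℕ → List ℕ
  varsT α j = concatMap (λ c → vars (proj₂ c)) (take j (conds (R α)))
  varsST : I → ℕ → List ℕ
  varsST α j = concatMap (λ c → vars (proj₁ c) ++ vars (proj₂ c)) (take j (conds (R α)))

  -- conditional rewrite relation  →_R = ⋃ₙ →_{Rₙ}

  RootR : ℕ → Term ar → Term ar → Set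
  RootR zero    s t = ⊥
  RootR (suc n) s t =
    Σ I λ α → Σ Subst λ σ →
      s ≡ lhs (R α) ⟨ σ ⟩ × t ≡ rhs (R α) ⟨ σ ⟩ ×
      All (λ c → Star (Ctx (RootR n)) (proj₁ c ⟨ σ ⟩) (proj₂ c ⟨ σ ⟩)) (conds (R α))

  Step : Term ar → Term ar → Set
  Step s t = ∃ λ n → Ctx (RootR n) s t

  RootU : Term ar → Term ar → Set
  RootU s t = Σ I λ α → Σ Subst λ σ → s ≡ lhs (R α) ⟨ σ ⟩ × t ≡ rhs (R α) ⟨ σ ⟩

  LhsNotVar : Set
  LhsNotVar = ∀ α x → ¬ (lhs (R α) ≡ var x)

  Deterministic : Set
  Deterministic = ∀ α →
    (∀ x → x ∈ vars (rhs (R α)) → x ∈ vars (lhs (R α)) ++ varsST α (k α)) ×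
    (∀ (i : Fin (k α)) x → x ∈ vars (cs α i) → x ∈ vars (lhs (R α)) ++ varsT α (toℕ i))

  DCTRS : Set
  DCTRS = LhsNotVar × Deterministic

  Defined : F → Set
  Defined f = Σ I λ α → Σ (Vec (Term ar) (ar f)) λ ts → lhs (R α) ≡ fun f ts

  LinearConstructor : Term ar → Set
  LinearConstructor t = Unique (vars t) × (∀ f → f ∈ funs t → ¬ Defined f)

  GroundIrreducible : Term ar → Set
  GroundIrreducible t = vars t ≡ [] × (∀ t' → ¬ Ctx RootU t t')

  RightStable : Set
  RightStable = ∀ α (i : Fin (k α)) →
    (LinearConstructor (ct α i) ⊎ GroundIrreducible (ct α i)) ×
    (∀ x → x ∈ vars (ct α i) →
       x ∉ vars (lhs (R α)) ++ varsST α (toℕ i) ++ vars (cs α i))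

  -- fixed ordering of X_{i+1} = Var(l, t₁, …, t_i): first occurrences, left to right
  Xs : (α : I) → Fin (k α) → List ℕ
  Xs α i = deduplicate _≟_ (vars (lhs (R α)) ++ varsT α (toℕ i))

  -- mixed signature: original symbols plus U^α_{i+1} for i : Fin k
  USym : Set
  USym = Σ I λ α → Fin (k α)

  MSym : Set
  MSym = F ⊎ USym

  marity : MSym → ℕ
  marity (inj₁ f)       = ar f
  marity (inj₂ (α , i)) = suc (length (Xs α i))

  MTerm : Set
  MTerm = Term marity

  emb  : Term ar → MTerm
  embV : ∀ {n} → Vec (Term ar) n → Vec MTerm n
  emb (var x)    = var x
  emb (fun f ts) = fun (inj₁ f) (embV ts)
  embV []       = []
  embV (t ∷ ts) = emb t ∷ embV ts

  Uterm : (α : I) (i : Fin (k α)) → MTerm → MTerm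
  Uterm α i w = fun (inj₂ (α , i)) (w ∷ V.map var (V.fromList (Xs α i)))

  data URule : MTerm → MTerm → Set where
    plain : ∀ α → k α ≡ 0 → URule (emb (lhs (R α))) (emb (rhs (R α)))
    first : ∀ α (i : Fin (k α)) → toℕ i ≡ 0 →
            URule (emb (lhs (R α))) (Uterm α i (emb (cs α i)))
    mid   : ∀ α (i j : Fin (k α)) → toℕ j ≡ suc (toℕ i) →
            URule (Uterm α i (emb (ct α i))) (Uterm α j (emb (cs α j)))
    last  : ∀ α (i : Fin (k α)) → suc (toℕ i) ≡ k α →
            URule (Uterm α i (emb (ct α i))) (emb (rhs (R α)))

  RootUseq : MTerm → MTerm → Set
  RootUseq s t = Σ MTerm λ l → Σ MTerm λ r → Σ (ℕ → MTerm) λ σ →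
    URule l r × s ≡ l ⟨ σ ⟩ × t ≡ r ⟨ σ ⟩

  Redex : MTerm → Set
  Redex s = Σ MTerm λ l → Σ MTerm λ r → Σ (ℕ → MTerm) λ σ →
    URule l r × s ≡ l ⟨ σ ⟩

  InnermostRoot : MTerm → MTerm → Set
  InnermostRoot s t = RootUseq s t × (∀ s' → s' ⊲ s → ¬ Redex s')

  InnermostStep : MTerm → MTerm → Set
  InnermostStep = Ctx InnermostRoot

  bind : (xs : List ℕ) → Vec (Term ar) (length xs) → Subst
  bind []       []       y = var y
  bind (x ∷ xs) (t ∷ ts) y = if does (x ≟ y) then t else bind xs ts y

  tb  : MTerm → Term ar
  tbV : ∀ {n} → Vec MTerm n → Vec (Term ar) n
  tb (var x)                      = var x
  tb (fun (inj₁ f) ts)            = fun f (tbV ts)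
  tb (fun (inj₂ (α , i)) (w ∷ vs)) = lhs (R α) ⟨ bind (Xs α i) (tbV vs) ⟩
  tbV []       = []
  tbV (t ∷ ts) = tb t ∷ tbV ts

-- Call a mixed term sound if each U-node U^α_{i+1}(w, v⃗) in it records genuine
-- progress: for the substitution τ that v⃗ induces on X_{i+1}, the conditions
-- s_j τ →*_R t_j τ hold for j ≤ i, s_{i+1} τ →*_R tb w, and the v⃗ are normal forms.
-- Embedded terms are sound, and an innermost U_seq-step on a sound term yields a sound
-- term and is simulated by R-steps on tb: opening or advancing a U-node, or rewriting
-- its first argument, leaves tb unchanged, while the last U-rule of α fires the
-- conditional rule itself, all of whose conditions are then certified. Innermostness is
-- what makes v⃗ normal forms when a node is created, so that τ never changes afterwards.

module Submission where

open import Defs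
open import Data.Nat using (ℕ; zero; suc; _≟_; _<_; _≤_; _⊔_; z≤n; s≤s)
open import Data.Nat.Properties using (<⇒≤; <-≤-trans; m≤m⊔n; m≤n⊔m; m≤n⇒m<n∨m≡n)
open import Data.Fin using (Fin; toℕ; zero; suc)
open import Data.Fin.Properties using (toℕ-injective; toℕ<n)
open import Data.List using (List; []; _∷_; _++_; length; concatMap; take; lookup)
open import Data.List.Membership.Propositional using (_∈_)
open import Data.List.Membership.Propositional.Properties
  using (∈-++⁺ˡ; ∈-++⁺ʳ; ∈-++⁻; ∈-deduplicate⁺; ∈-deduplicate⁻)
open import Data.List.Relation.Binary.Subset.Propositional using (_⊆_)
open import Data.List.Relation.Unary.Any using (here; there)
open import Data.List.Relation.Unary.All as All using (All; []; _∷_)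
open import Data.Vec as V using (Vec; []; _∷_)
open import Data.Vec.Properties using (lookup∘update; []≔-idempotent; []≔-lookup)
open import Data.Product using (∃-syntax; _×_; _,_; proj₁; proj₂)
open import Data.Sum as Sum using (_⊎_; inj₁; inj₂)
open import Data.Empty using (⊥-elim)
open import Data.Unit using (⊤; tt)
open import Function using (_∘_)
open import Relation.Nullary using (¬_; yes; no)
open import Relation.Nullary.Decidable using (dec-true; dec-false)
open import Relation.Binary.PropositionalEquality
open import Relation.Binary.Construct.Closure.ReflexiveTransitive as Star
  using (Star; ε; _◅_; _◅◅_)

<suc⇒<⊎≡ : ∀ {n} {i j : Fin n} → toℕ j < suc (toℕ i) → toℕ j < toℕ i ⊎ j ≡ i
<suc⇒<⊎≡ (s≤s j≤i) = Sum.map₂ toℕ-injective (m≤n⇒m<n∨m≡n j≤i)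

module _ {A B : Set} (f : A → List B) where

  ∈-concatMap-take⁻ : ∀ (xs : List A) n {y} → y ∈ concatMap f (take n xs) →
                      ∃[ j ] toℕ j < n × y ∈ f (lookup xs j)
  ∈-concatMap-take⁻ (x ∷ xs) (suc n) p with ∈-++⁻ (f x) p
  ... | inj₁ q = zero , s≤s z≤n , q
  ... | inj₂ q with ∈-concatMap-take⁻ xs n q
  ...   | j , j<n , r = suc j , s≤s j<n , r

  ∈-concatMap-take⁺ : ∀ (xs : List A) n (j : Fin (length xs)) {y} → toℕ j < n →
                      y ∈ f (lookup xs j) → y ∈ concatMap f (take n xs)
  ∈-concatMap-take⁺ (x ∷ xs) (suc n) zero    _         p = ∈-++⁺ˡ p
  ∈-concatMap-take⁺ (x ∷ xs) (suc n) (suc j) (s≤s j<n) p =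
    ∈-++⁺ʳ (f x) (∈-concatMap-take⁺ xs n j j<n p)

module _ {S : Set} {a : S → ℕ} where

  infix 4 _⊴_
  _⊴_ : Term a → Term a → Set
  s ⊴ t = s ≡ t ⊎ s ⊲ t

  ⊲-trans : ∀ {s t u : Term a} → s ⊲ t → t ⊲ u → s ⊲ u
  ⊲-trans p (imm i)    = deep i p
  ⊲-trans p (deep i q) = deep i (⊲-trans p q)

  ⊴-⊲-trans : ∀ {s t u : Term a} → s ⊴ t → t ⊲ u → s ⊲ u
  ⊴-⊲-trans (inj₁ refl) q = q
  ⊴-⊲-trans (inj₂ p)    q = ⊲-trans p q

  ∈vars⇒⊴   : ∀ (σ : Subst) (t : Term a) {x} → x ∈ vars t → σ x ⊴ t ⟨ σ ⟩
  ∈varsV⇒⊲  : ∀ (σ : Subst) {f} (ts : Vec (Term a) (a f)) {x} →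
              x ∈ varsV ts → σ x ⊲ (fun f ts ⟨ σ ⟩)
  ∈varsV⇒⊴ : ∀ (σ : Subst) {n} (ts : Vec (Term a) n) {x} →
              x ∈ varsV ts → ∃[ i ] σ x ⊴ V.lookup (substV ts σ) i
  ∈vars⇒⊴ σ (var x)    (here refl) = inj₁ refl
  ∈vars⇒⊴ σ (fun f ts) p           = inj₂ (∈varsV⇒⊲ σ ts p)
  ∈varsV⇒⊲ σ ts p = let i , q = ∈varsV⇒⊴ σ ts p in ⊴-⊲-trans q (imm i)
  ∈varsV⇒⊴ σ (t ∷ ts) p with ∈-++⁻ (vars t) p
  ... | inj₁ q = zero , ∈vars⇒⊴ σ t q
  ... | inj₂ q = let i , r = ∈varsV⇒⊴ σ ts q in suc i , r

  ⟨⟩-agree : ∀ (t : Term a) {σ ρ : Subst} → (∀ {x} → x ∈ vars t → σ x ≡ ρ x) →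
             t ⟨ σ ⟩ ≡ t ⟨ ρ ⟩
  substV-agree : ∀ {n} (ts : Vec (Term a) n) {σ ρ : Subst} →
                 (∀ {x} → x ∈ varsV ts → σ x ≡ ρ x) → substV ts σ ≡ substV ts ρ
  ⟨⟩-agree (var x)    agree = agree (here refl)
  ⟨⟩-agree (fun f ts) agree = cong (fun f) (substV-agree ts agree)
  substV-agree []       agree = refl
  substV-agree (t ∷ ts) agree =
    cong₂ _∷_ (⟨⟩-agree t (agree ∘ ∈-++⁺ˡ)) (substV-agree ts (agree ∘ ∈-++⁺ʳ (vars t)))

  ⟨var⟩-identity  : ∀ (t : Term a) → t ⟨ var ⟩ ≡ t
  substV-identity : ∀ {n} (ts : Vec (Term a) n) → substV ts var ≡ ts
  ⟨var⟩-identity (var x)    = refl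
  ⟨var⟩-identity (fun f ts) = cong (fun f) (substV-identity ts)
  substV-identity []       = refl
  substV-identity (t ∷ ts) = cong₂ _∷_ (⟨var⟩-identity t) (substV-identity ts)

  varsV-map-var : ∀ (xs : List ℕ) → varsV {a = a} (V.map var (V.fromList xs)) ≡ xs
  varsV-map-var []       = refl
  varsV-map-var (x ∷ xs) = cong (x ∷_) (varsV-map-var xs)

  Ctx-map : ∀ {P Q : Term a → Term a → Set} → (∀ {s t} → P s t → Q s t) →
            ∀ {s t} → Ctx P s t → Ctx Q s t
  Ctx-map g (root p)  = root (g p)
  Ctx-map g (arg i c) = arg i (Ctx-map g c)

  Ctx-at : ∀ {P : Term a → Term a → Set} {f} (us : Vec (Term a) (a f)) (i : Fin (a f)) {s t} →
           Ctx P s t → Ctx P (fun f (us V.[ i ]≔ s)) (fun f (us V.[ i ]≔ t))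
  Ctx-at {P} {f} us i {s} {t} c =
    subst (λ vs → Ctx P (fun f (us V.[ i ]≔ s)) (fun f vs)) ([]≔-idempotent us i)
      (arg i (subst (λ u → Ctx P u t) (sym (lookup∘update i us s)) c))

module _ {F : Set} {ar : F → ℕ} {I : Set} (R : I → Rule ar) where

  infix 4 _⟶*_
  _⟶*_ : Term ar → Term ar → Set
  _⟶*_ = Star (Step R)

  ≡⇒⟶* : ∀ {s t} → s ≡ t → s ⟶* t
  ≡⇒⟶* refl = ε

  RootR-mono : ∀ {m n s t} → m ≤ n → RootR R m s t → RootR R n s t
  Ctx*-mono  : ∀ {m n s t} → m ≤ n → Star (Ctx (RootR R m)) s t → Star (Ctx (RootR R n)) s t
  RootR-mono {zero} _ ()
  RootR-mono (s≤s m≤n) (α , σ , s≡ , t≡ , hold) = α , σ , s≡ , t≡ , All.map (Ctx*-mono m≤n) hold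
  Ctx*-mono m≤n = Star.map (Ctx-map (RootR-mono m≤n))

  ⟶*-level : ∀ {s t} → s ⟶* t → ∃[ n ] Star (Ctx (RootR R n)) s t
  ⟶*-level ε = 0 , ε
  ⟶*-level ((m , step) ◅ steps) with ⟶*-level steps
  ... | n , steps′ = m ⊔ n , Ctx*-mono (m≤m⊔n m n) (step ◅ ε) ◅◅ Ctx*-mono (m≤n⊔m m n) steps′

  conditions-level : ∀ {ρ : Subst} (cs : List (Term ar × Term ar)) →
    (∀ j → proj₁ (lookup cs j) ⟨ ρ ⟩ ⟶* proj₂ (lookup cs j) ⟨ ρ ⟩) →
    ∃[ n ] All (λ c → Star (Ctx (RootR R n)) (proj₁ c ⟨ ρ ⟩) (proj₂ c ⟨ ρ ⟩)) cs
  conditions-level []       _    = 0 , []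
  conditions-level (c ∷ cs) hold with ⟶*-level (hold zero) | conditions-level cs (hold ∘ suc)
  ... | m , p | n , ps = m ⊔ n , Ctx*-mono (m≤m⊔n m n) p ∷ All.map (Ctx*-mono (m≤n⊔m m n)) ps

  ⟶*-at : ∀ {f} (us : Vec (Term ar) (ar f)) (i : Fin (ar f)) {s t} →
          s ⟶* t → fun f (us V.[ i ]≔ s) ⟶* fun f (us V.[ i ]≔ t)
  ⟶*-at us i = Star.gmap (λ s → fun _ (us V.[ i ]≔ s)) (λ (n , step) → n , Ctx-at us i step)

  -- X α n is the paper's X_{n+1}, with repetitions; Xs R α i orders X α (toℕ i).
  X : I → ℕ → List ℕ
  X α n = vars (lhs (R α)) ++ varsT R α n

  CondsHold : I → ℕ → Subst → Set
  CondsHold α n ρ = ∀ (j : Fin (k R α)) → toℕ j < n → cs R α j ⟨ ρ ⟩ ⟶* ct R α j ⟨ ρ ⟩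

  CondsHold-zero : ∀ α ρ → CondsHold α 0 ρ
  CondsHold-zero α ρ j ()

  CondsHold-suc : ∀ α (i : Fin (k R α)) {ρ} → CondsHold α (toℕ i) ρ →
                  cs R α i ⟨ ρ ⟩ ⟶* ct R α i ⟨ ρ ⟩ → CondsHold α (suc (toℕ i)) ρ
  CondsHold-suc α i hold hold-i j j<1+i with <suc⇒<⊎≡ {i = i} j<1+i
  ... | inj₁ j<i  = hold j j<i
  ... | inj₂ refl = hold-i

  CondsHold⇒Step : ∀ α {ρ} → CondsHold α (k R α) ρ → Step R (lhs (R α) ⟨ ρ ⟩) (rhs (R α) ⟨ ρ ⟩)
  CondsHold⇒Step α {ρ} hold =
    let n , conds-n = conditions-level (conds (R α)) (λ j → hold j (toℕ<n j))
    in  suc n , root (α , ρ , refl , refl , conds-n)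

  ct⊆X : ∀ α (j : Fin (k R α)) {n} → toℕ j < n → vars (ct R α j) ⊆ X α n
  ct⊆X α j j<n p =
    ∈-++⁺ʳ (vars (lhs (R α))) (∈-concatMap-take⁺ (vars ∘ proj₂) (conds (R α)) _ j j<n p)

  X-mono : ∀ α {m n} → m ≤ n → X α m ⊆ X α n
  X-mono α m≤n p with ∈-++⁻ (vars (lhs (R α))) p
  ... | inj₁ q = ∈-++⁺ˡ q
  ... | inj₂ q with ∈-concatMap-take⁻ (vars ∘ proj₂) (conds (R α)) _ q
  ...   | j , j<m , r = ct⊆X α j (<-≤-trans j<m m≤n) r

  X-suc : ∀ α (i : Fin (k R α)) → X α (suc (toℕ i)) ⊆ vars (ct R α i) ++ X α (toℕ i)
  X-suc α i p with ∈-++⁻ (vars (lhs (R α))) p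
  ... | inj₁ q = ∈-++⁺ʳ (vars (ct R α i)) (∈-++⁺ˡ q)
  ... | inj₂ q with ∈-concatMap-take⁻ (vars ∘ proj₂) (conds (R α)) _ q
  ...   | j , j<1+i , r with <suc⇒<⊎≡ {i = i} j<1+i
  ...     | inj₁ j<i  = ∈-++⁺ʳ (vars (ct R α i)) (ct⊆X α j j<i r)
  ...     | inj₂ refl = ∈-++⁺ˡ r

  X-zero : ∀ α → X α 0 ⊆ vars (lhs (R α))
  X-zero α p with ∈-++⁻ (vars (lhs (R α))) p
  ... | inj₁ q = q

  module _ (det : Deterministic R) where

    cs⊆X : ∀ α (j : Fin (k R α)) → vars (cs R α j) ⊆ X α (toℕ j)
    cs⊆X α j = proj₂ (det α) j _

    rhs⊆X : ∀ α → vars (rhs (R α)) ⊆ X α (k R α)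
    rhs⊆X α p with ∈-++⁻ (vars (lhs (R α))) (proj₁ (det α) _ p)
    ... | inj₁ q = ∈-++⁺ˡ q
    ... | inj₂ q
      with ∈-concatMap-take⁻ (λ c → vars (proj₁ c) ++ vars (proj₂ c)) (conds (R α)) (k R α) q
    ...   | j , j<k , r with ∈-++⁻ (vars (cs R α j)) r
    ...     | inj₁ in-s = X-mono α (<⇒≤ j<k) (cs⊆X α j in-s)
    ...     | inj₂ in-t = ct⊆X α j j<k in-t

    CondsHold-agree : ∀ α n {ρ ρ′ : Subst} → (∀ {x} → x ∈ X α n → ρ x ≡ ρ′ x) →
                      CondsHold α n ρ → CondsHold α n ρ′
    CondsHold-agree α n agree hold j j<n =
      subst₂ _⟶*_ (⟨⟩-agree (cs R α j) (λ p → agree (X-mono α (<⇒≤ j<n) (cs⊆X α j p))))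
                  (⟨⟩-agree (ct R α j) (λ p → agree (ct⊆X α j j<n p)))
                  (hold j j<n)

  MT : Set
  MT = MTerm R

  substVars : (xs : List ℕ) → (ℕ → MT) → Vec MT (length xs)
  substVars xs σ = substV (V.map var (V.fromList xs)) σ

  tb-emb-⟨⟩   : ∀ (t : Term ar) (σ : ℕ → MT) → tb R (emb R t ⟨ σ ⟩) ≡ t ⟨ tb R ∘ σ ⟩
  tbV-embV-⟨⟩ : ∀ {n} (ts : Vec (Term ar) n) (σ : ℕ → MT) →
                tbV R (substV (embV R ts) σ) ≡ substV ts (tb R ∘ σ)
  tb-emb-⟨⟩ (var x)    σ = refl
  tb-emb-⟨⟩ (fun f ts) σ = cong (fun f) (tbV-embV-⟨⟩ ts σ)
  tbV-embV-⟨⟩ []       σ = refl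
  tbV-embV-⟨⟩ (t ∷ ts) σ = cong₂ _∷_ (tb-emb-⟨⟩ t σ) (tbV-embV-⟨⟩ ts σ)

  vars-emb  : ∀ (t : Term ar) → vars (emb R t) ≡ vars t
  varsV-embV : ∀ {n} (ts : Vec (Term ar) n) → varsV (embV R ts) ≡ varsV ts
  vars-emb (var x)    = refl
  vars-emb (fun f ts) = varsV-embV ts
  varsV-embV []       = refl
  varsV-embV (t ∷ ts) = cong₂ _++_ (vars-emb t) (varsV-embV ts)

  tbV-update : ∀ {n} (ts : Vec MT n) i t → tbV R (ts V.[ i ]≔ t) ≡ tbV R ts V.[ i ]≔ tb R t
  tbV-update (s ∷ ts) zero    t = refl
  tbV-update (s ∷ ts) (suc i) t = cong (tb R s ∷_) (tbV-update ts i t)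

  bind-substVars : ∀ (xs : List ℕ) (σ : ℕ → MT) {x} → x ∈ xs →
                   bind R xs (tbV R (substVars xs σ)) x ≡ tb R (σ x)
  bind-substVars (x ∷ xs) σ (here refl) rewrite dec-true (x ≟ x) refl = refl
  bind-substVars (y ∷ xs) σ {x} (there p) with y ≟ x
  ... | yes refl rewrite dec-true (x ≟ x) refl = refl
  ... | no y≢x   rewrite dec-false (y ≟ x) y≢x = bind-substVars xs σ p

  bind-Xs : ∀ α (i : Fin (k R α)) (σ : ℕ → MT) {x} → x ∈ X α (toℕ i) →
            bind R (Xs R α i) (tbV R (substVars (Xs R α i) σ)) x ≡ tb R (σ x)
  bind-Xs α i σ p = bind-substVars (Xs R α i) σ (∈-deduplicate⁺ _≟_ p)

  tb-Uterm : ∀ α (i : Fin (k R α)) (w : MT) (σ : ℕ → MT) →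
             tb R (Uterm R α i w ⟨ σ ⟩) ≡ lhs (R α) ⟨ tb R ∘ σ ⟩
  tb-Uterm α i w σ = ⟨⟩-agree (lhs (R α)) (λ p → bind-Xs α i σ (∈-++⁺ˡ p))

  varsV-Uterm-args : ∀ α (i : Fin (k R α)) (t : Term ar) →
                     varsV (emb R t ∷ V.map var (V.fromList (Xs R α i))) ≡ vars t ++ Xs R α i
  varsV-Uterm-args α i t = cong₂ _++_ (vars-emb t) (varsV-map-var (Xs R α i))

  NoProperRedex : MT → Set
  NoProperRedex s = ∀ s′ → s′ ⊲ s → ¬ Redex R s′

  NormalForm : MT → Set
  NormalForm s = ¬ Redex R s × NoProperRedex s

  step-redex : ∀ {s t} → InnermostStep R s t → ∃[ s′ ] s′ ⊴ s × Redex R s′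
  step-redex (root ((l , r , σ , rule , s≡ , _) , _)) = _ , inj₁ refl , l , r , σ , rule , s≡
  step-redex (arg i step) =
    let s′ , s′⊴ , redex = step-redex step in s′ , inj₂ (⊴-⊲-trans s′⊴ (imm i)) , redex

  NormalForm-irreducible : ∀ {s t} → NormalForm s → ¬ InnermostStep R s t
  NormalForm-irreducible (irred , inner) step with step-redex step
  ... | _  , inj₁ refl , redex = irred redex
  ... | s′ , inj₂ s′⊲s , redex = inner s′ s′⊲s redex

  Sound  : MT → Set
  SoundV : ∀ {n} → Vec MT n → Set
  Sound (var x)                     = ⊤
  Sound (fun (inj₁ f) ts)           = SoundV ts
  Sound (fun (inj₂ (α , i)) (w ∷ vs)) =
    Sound w × SoundV vs × (∀ j → NormalForm (V.lookup vs j)) ×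
    CondsHold α (toℕ i) τ × cs R α i ⟨ τ ⟩ ⟶* tb R w
    where τ = bind R (Xs R α i) (tbV R vs)
  SoundV []       = ⊤
  SoundV (t ∷ ts) = Sound t × SoundV ts

  SoundV-lookup : ∀ {n} (ts : Vec MT n) i → SoundV ts → Sound (V.lookup ts i)
  SoundV-lookup (t ∷ ts) zero    (sound , _) = sound
  SoundV-lookup (t ∷ ts) (suc i) (_ , sound) = SoundV-lookup ts i sound

  SoundV-update : ∀ {n} (ts : Vec MT n) i t → SoundV ts → Sound t → SoundV (ts V.[ i ]≔ t)
  SoundV-update (s ∷ ts) zero    t (_  , sound) sound-t = sound-t , sound
  SoundV-update (s ∷ ts) (suc i) t (sound-s , sound) sound-t =
    sound-s , SoundV-update ts i t sound sound-t

  Sound-arg : ∀ f ts i → Sound (fun f ts) → Sound (V.lookup ts i)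
  Sound-arg (inj₁ f) ts       i       sound = SoundV-lookup ts i sound
  Sound-arg (inj₂ _) (w ∷ vs) zero    sound = proj₁ sound
  Sound-arg (inj₂ _) (w ∷ vs) (suc i) sound = SoundV-lookup vs i (proj₁ (proj₂ sound))

  Sound-⊲ : ∀ {s t} → s ⊲ t → Sound t → Sound s
  Sound-⊲ (imm {f} {ts} i)        sound = Sound-arg f ts i sound
  Sound-⊲ (deep {f = f} {ts} i p) sound = Sound-⊲ p (Sound-arg f ts i sound)

  Sound-emb-⟨⟩  : ∀ (t : Term ar) (σ : ℕ → MT) → (∀ {x} → x ∈ vars t → Sound (σ x)) →
                  Sound (emb R t ⟨ σ ⟩)
  SoundV-embV-⟨⟩ : ∀ {n} (ts : Vec (Term ar) n) (σ : ℕ → MT) →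
                   (∀ {x} → x ∈ varsV ts → Sound (σ x)) → SoundV (substV (embV R ts) σ)
  Sound-emb-⟨⟩ (var x)    σ sound = sound (here refl)
  Sound-emb-⟨⟩ (fun f ts) σ sound = SoundV-embV-⟨⟩ ts σ sound
  SoundV-embV-⟨⟩ []       σ sound = tt
  SoundV-embV-⟨⟩ (t ∷ ts) σ sound =
    Sound-emb-⟨⟩ t σ (sound ∘ ∈-++⁺ˡ) , SoundV-embV-⟨⟩ ts σ (sound ∘ ∈-++⁺ʳ (vars t))

  SoundNF : (ℕ → MT) → List ℕ → Set
  SoundNF σ xs = ∀ {x} → x ∈ xs → Sound (σ x) × NormalForm (σ x)

  SoundV-substVars : ∀ (xs : List ℕ) (σ : ℕ → MT) → SoundNF σ xs → SoundV (substVars xs σ)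
  SoundV-substVars []       σ good = tt
  SoundV-substVars (x ∷ xs) σ good =
    proj₁ (good (here refl)) , SoundV-substVars xs σ (good ∘ there)

  NormalForm-substVars : ∀ (xs : List ℕ) (σ : ℕ → MT) → SoundNF σ xs →
                         ∀ j → NormalForm (V.lookup (substVars xs σ) j)
  NormalForm-substVars (x ∷ xs) σ good zero    = proj₂ (good (here refl))
  NormalForm-substVars (x ∷ xs) σ good (suc j) = NormalForm-substVars xs σ (good ∘ there) j

  SoundNF-args : ∀ {f} (ts : Vec MT (marity R f)) (σ : ℕ → MT) →
                 NoProperRedex (fun f ts ⟨ σ ⟩) → Sound (fun f ts ⟨ σ ⟩) → SoundNF σ (varsV ts)
  SoundNF-args ts σ inner sound p =
    let σx⊲ = ∈varsV⇒⊲ σ ts p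
    in  Sound-⊲ σx⊲ sound , inner _ σx⊲ , λ s′ s′⊲σx → inner s′ (⊲-trans s′⊲σx σx⊲)

  module _ (lhs≢var : LhsNotVar R) (det : Deterministic R) where

    Reached : I → ℕ → (ℕ → MT) → Set
    Reached α n σ = SoundNF σ (X α n) × CondsHold α n (tb R ∘ σ)

    reached-lhs : ∀ α (σ : ℕ → MT) → NoProperRedex (emb R (lhs (R α)) ⟨ σ ⟩) →
                  Sound (emb R (lhs (R α)) ⟨ σ ⟩) → Reached α 0 σ
    reached-lhs α σ inner sound with lhs (R α) | lhs≢var α | X-zero α
    ... | var x    | l≢var | _     = ⊥-elim (l≢var x refl)
    ... | fun f ts | _     | X⊆vl  =
      (λ p → SoundNF-args (embV R ts) σ inner sound (subst (_ ∈_) (sym (varsV-embV ts)) (X⊆vl p))) ,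
      CondsHold-zero α (tb R ∘ σ)

    reached-Uterm : ∀ α (i : Fin (k R α)) (σ : ℕ → MT) →
                    NoProperRedex (Uterm R α i (emb R (ct R α i)) ⟨ σ ⟩) →
                    Sound (Uterm R α i (emb R (ct R α i)) ⟨ σ ⟩) → Reached α (suc (toℕ i)) σ
    reached-Uterm α i σ inner sound@(_ , _ , _ , hold , reduces) =
      (λ p → SoundNF-args (emb R (ct R α i) ∷ V.map var (V.fromList (Xs R α i))) σ inner sound
               (subst (_ ∈_) (sym (varsV-Uterm-args α i (ct R α i))) (dedup (X-suc α i p)))) ,
      CondsHold-suc α i (CondsHold-agree det α (toℕ i) (bind-Xs α i σ) hold)
        (subst₂ _⟶*_ (⟨⟩-agree (cs R α i) (λ p → bind-Xs α i σ (cs⊆X det α i p)))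
                     (tb-emb-⟨⟩ (ct R α i) σ) reduces)
      where
      dedup : vars (ct R α i) ++ X α (toℕ i) ⊆ vars (ct R α i) ++ Xs R α i
      dedup p with ∈-++⁻ (vars (ct R α i)) p
      ... | inj₁ q = ∈-++⁺ˡ q
      ... | inj₂ q = ∈-++⁺ʳ (vars (ct R α i)) (∈-deduplicate⁺ _≟_ q)

    Sound-Uterm : ∀ α (j : Fin (k R α)) (σ : ℕ → MT) → Reached α (toℕ j) σ →
                  Sound (Uterm R α j (emb R (cs R α j)) ⟨ σ ⟩)
    Sound-Uterm α j σ (good , hold) =
      Sound-emb-⟨⟩ (cs R α j) σ (λ p → proj₁ (good (cs⊆X det α j p))) ,
      SoundV-substVars (Xs R α j) σ goodXs ,
      NormalForm-substVars (Xs R α j) σ goodXs ,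
      CondsHold-agree det α (toℕ j) (sym ∘ bind-Xs α j σ) hold ,
      ≡⇒⟶* (trans (⟨⟩-agree (cs R α j) (λ p → bind-Xs α j σ (cs⊆X det α j p)))
                  (sym (tb-emb-⟨⟩ (cs R α j) σ)))
      where
      goodXs : SoundNF σ (Xs R α j)
      goodXs p = good (∈-deduplicate⁻ _≟_ _ p)

    Sound-rhs : ∀ α (σ : ℕ → MT) → Reached α (k R α) σ → Sound (emb R (rhs (R α)) ⟨ σ ⟩)
    Sound-rhs α σ (good , _) = Sound-emb-⟨⟩ (rhs (R α)) σ (λ p → proj₁ (good (rhs⊆X det α p)))

    Reached-subst : ∀ α {m n} σ → m ≡ n → Reached α m σ → Reached α n σ
    Reached-subst α σ m≡n = subst (λ n → Reached α n σ) m≡n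

    sound-root : ∀ {l r} → URule R l r → (σ : ℕ → MT) →
                 NoProperRedex (l ⟨ σ ⟩) → Sound (l ⟨ σ ⟩) →
                 Sound (r ⟨ σ ⟩) × tb R (l ⟨ σ ⟩) ⟶* tb R (r ⟨ σ ⟩)
    sound-root (plain α k≡0) σ inner sound =
      Sound-rhs α σ reached ,
      subst₂ _⟶*_ (sym (tb-emb-⟨⟩ (lhs (R α)) σ)) (sym (tb-emb-⟨⟩ (rhs (R α)) σ))
             (CondsHold⇒Step α (proj₂ reached) ◅ ε)
      where reached = Reached-subst α σ (sym k≡0) (reached-lhs α σ inner sound)
    sound-root (first α i i≡0) σ inner sound =
      Sound-Uterm α i σ (Reached-subst α σ (sym i≡0) (reached-lhs α σ inner sound)) ,
      ≡⇒⟶* (trans (tb-emb-⟨⟩ (lhs (R α)) σ) (sym (tb-Uterm α i (emb R (cs R α i)) σ)))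
    sound-root (mid α i j j≡1+i) σ inner sound =
      Sound-Uterm α j σ (Reached-subst α σ (sym j≡1+i) (reached-Uterm α i σ inner sound)) ,
      ≡⇒⟶* (trans (tb-Uterm α i (emb R (ct R α i)) σ) (sym (tb-Uterm α j (emb R (cs R α j)) σ)))
    sound-root (last α i 1+i≡k) σ inner sound =
      Sound-rhs α σ reached ,
      subst₂ _⟶*_ (sym (tb-Uterm α i (emb R (ct R α i)) σ)) (sym (tb-emb-⟨⟩ (rhs (R α)) σ))
             (CondsHold⇒Step α (proj₂ reached) ◅ ε)
      where reached = Reached-subst α σ 1+i≡k (reached-Uterm α i σ inner sound)

    sound-step : ∀ {s t} → InnermostStep R s t → Sound s → Sound t × tb R s ⟶* tb R t
    sound-step (root ((l , r , σ , rule , refl , refl) , inner)) = sound-root rule σ inner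
    sound-step (arg {inj₁ f} {ts} {t} i step) sound =
      let sound-t , reduces = sound-step step (SoundV-lookup ts i sound)
      in  SoundV-update ts i t sound sound-t ,
          subst₂ (λ us vs → fun f us ⟶* fun f vs)
                 (trans (sym (tbV-update ts i _)) (cong (tbV R) ([]≔-lookup ts i)))
                 (sym (tbV-update ts i t))
                 (⟶*-at (tbV R ts) i reduces)
    -- tb ignores the first argument of a U-node.
    sound-step (arg {inj₂ _} {w ∷ vs} zero step) (sound-w , rest , nf , hold , reduces) =
      let sound-w′ , reduces′ = sound-step step sound-w
      in  (sound-w′ , rest , nf , hold , reduces ◅◅ reduces′) , ε
    sound-step (arg {inj₂ _} {w ∷ vs} (suc i) step) (_ , _ , nf , _) =
      ⊥-elim (NormalForm-irreducible (nf i) step)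

    sound-steps : ∀ {s t} → Star (InnermostStep R) s t → Sound s → tb R s ⟶* tb R t
    sound-steps ε              _     = ε
    sound-steps (step ◅ steps) sound =
      let sound′ , reduces = sound-step step sound in reduces ◅◅ sound-steps steps sound′

lemma13 : {F : Set} {ar : F → ℕ} {I : Set} (R : I → Rule ar) →
          DCTRS R → RightStable R →
          (u : Term ar) (v : MTerm R) →
          Star (InnermostStep R) (emb R u) v →
          Star (Step R) u (tb R v)
lemma13 R (lhs≢var , det) _ u v derivation =
  subst (λ s → _⟶*_ R s (tb R v)) tb-emb-u
    (sound-steps R lhs≢var det (subst (λ s → Star (InnermostStep R) s v) (sym emb-u≡) derivation)
                               (Sound-emb-⟨⟩ R u var (λ _ → tt)))
  where
  emb-u≡ : emb R u ⟨ var ⟩ ≡ emb R u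
  emb-u≡ = ⟨var⟩-identity (emb R u)
  tb-emb-u : tb R (emb R u ⟨ var ⟩) ≡ u
  tb-emb-u = trans (tb-emb-⟨⟩ R u var) (⟨var⟩-identity u)
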